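{- Let $G$ be a hidden graph on vertex set $V$ accessible via a CC oracle, and let $S\subseteq V$. A maximal independent set of $G[S]$ can be computed with $\mathcal{O}(|S|)$ CC queries, and there are instances where $\Omega(|S|)$ CC queries are needed.
   Context: A CC oracle for a graph $G$ on $V$, on query $T\subseteq V$, returns the partition of $T$ into the vertex sets of the connected components of the induced subgraph $G[T]$. A maximal independent set of $G[S]$ is an independent set of $G[S]$ none of whose proper supersets within $S$ is independent. Computing it with CC queries means the procedure's output must be guaranteed (from the query answers alone) to be a maximal independent set of $G[S]$. -}

module Defs where

open import Data.Nat using (ℕ; zero; suc)
open import Data.Bool using (Bool; true; false)
open import Data.Fin using (Fin)
open import Data.Fin.Subset using (Subset; _∈_; _∉_; _⊆_; _⊂_)
open import Data.Product using (Σ; _×_)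
open import Relation.Binary.PropositionalEquality using (_≡_)
open import Relation.Nullary using (¬_)
open import Function.Bundles using (_⇔_)

record Graph (n : ℕ) : Set where
  field
    adj    : Fin n → Fin n → Bool
    sym    : ∀ u v → adj u v ≡ adj v u
    irrefl : ∀ v → adj v v ≡ false
open Graph public

data PathIn {n : ℕ} (G : Graph n) (T : Subset n) : Fin n → Fin n → Set where
  here : ∀ {u} → u ∈ T → PathIn G T u u
  step : ∀ {u w v} → u ∈ T → adj G u w ≡ true → PathIn G T w v → PathIn G T u v

-- An oracle answer: the partition of T into components of G[T], encoded as
-- its equivalence relation on T ("u and v lie in the same block").
Answer : ℕ → Set
Answer n = Fin n → Fin n → Bool

CCAnswer : ∀ {n} → Graph n → Subset n → Answer n → Set
CCAnswer G T A = ∀ u v → (A u v ≡ true) ⇔ PathIn G T u v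

-- Adaptive deterministic CC-query algorithms (decision trees): either output
-- a vertex set, or ask a query T and continue depending on the answer.
data Alg (n : ℕ) : Set where
  ret : Subset n → Alg n
  ask : Subset n → (Answer n → Alg n) → Alg n

data Run {n : ℕ} (G : Graph n) : Alg n → Subset n → ℕ → Set where
  ret : ∀ {I} → Run G (ret I) I zero
  ask : ∀ {T f A I k} → CCAnswer G T A → Run G (f A) I k → Run G (ask T f) I (suc k)

Independent : ∀ {n} → Graph n → Subset n → Set
Independent G I = ∀ u v → u ∈ I → v ∈ I → adj G u v ≡ false

IndepIn : ∀ {n} → Graph n → Subset n → Subset n → Set
IndepIn G S I = I ⊆ S × Independent G I

MaximalIndepIn : ∀ {n} → Graph n → Subset n → Subset n → Set
MaximalIndepIn G S I = IndepIn G S I × (∀ J → I ⊂ J → J ⊆ S → ¬ Independent G J)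

ComputesMIS : {n : ℕ} → Graph n → Subset n → Alg n → Set
ComputesMIS {n} G S a =
  Σ (Subset n) (λ I → Σ ℕ (λ k → Run G a I k)) ×
  (∀ I k → Run G a I k → MaximalIndepIn G S I)

{-# OPTIONS --safe #-}
module Submission where

-- Upper bound: scan S once, keeping an independent set I, and query I ∪ {v} for
-- each vertex v.  Since I is independent, every edge of G[I ∪ {v}] contains v, so
-- the component of v is v together with its neighbours in I: the answer tells
-- whether v has a neighbour in I, and v is added exactly when it has none.  The
-- result is independent and dominates S, hence maximal, after |S| queries.
--
-- Lower bound: take S = V and G complete, so any correct run outputs a single
-- vertex v.  For w ≠ v, deleting the edge vw changes the answer only to the
-- query {v, w}; a run that never asks it is also a run on G - vw, where {v} is
-- not maximal.  So each of the |S| - 1 sets {v, w} is asked.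

open import Defs
open import Data.Bool using (true; false)
open import Data.Bool.Properties using (¬-not) renaming (_≟_ to _≟ᵇ_)
open import Data.Fin using (Fin; zero; suc; punchIn)
open import Data.Fin.Properties using (_≟_; any?; punchInᵢ≢i; punchIn-injective; injective⇒≤)
open import Data.Fin.Subset using (Subset; ∣_∣; _∈_; _∉_; _⊆_; _⊂_; _∪_; ⁅_⁆; ⊥; ⊤)
open import Data.Fin.Subset.Properties
  using (_∈?_; ∉⊥; ∈⊤; ⊆⊤; ∣⊤∣≡n; x∈⁅x⁆; x∈⁅y⁆⇒x≡y; p⊆p∪q; q⊆p∪q; x∈p∪q⁻; nonempty?; ⊆-antisym)
open import Data.List using (List; []; _∷_; map; length)
open import Data.List.Properties using (length-map)
open import Data.List.Membership.Propositional using () renaming (_∈_ to _∈ₗ_)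
open import Data.List.Membership.Propositional.Properties using (∈-map⁺; ∈-map⁻)
import Data.List.Relation.Unary.Any as Any
open import Data.Nat using (ℕ; zero; suc; _*_; _+_; _≤_; z≤n; s≤s)
open import Data.Nat.Properties using (≤-reflexive; *-identityˡ; +-comm)
open import Data.Product using (Σ; _×_; _,_; proj₁; proj₂; ∃; swap)
open import Data.Sum using (_⊎_; inj₁; inj₂)
open import Data.Vec using ([]; _∷_; here; there)
open import Data.Vec.Properties using (≡-dec)
open import Function using (_∘_; id)
open import Function.Bundles using (mk⇔; Equivalence)
open import Relation.Binary.Definitions using (Decidable; Symmetric)
open import Relation.Binary.PropositionalEquality using (_≡_; _≢_; refl; trans; cong; subst; subst₂)
import Relation.Binary.PropositionalEquality as ≡
open import Relation.Nullary using (¬_; Dec; yes; no; does; ¬?; contradiction)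
open import Relation.Nullary.Decidable using (_×-dec_; _⊎-dec_; dec-true; dec-false; does-⇔)

does⇒ : ∀ {P : Set} (P? : Dec P) → does P? ≡ true → P
does⇒ (yes p) _ = p

⊆∧≢⇒⊂ : ∀ {n} {p q : Subset n} → p ⊆ q → p ≢ q → p ⊂ q
⊆∧≢⇒⊂ {p = p} {q} p⊆q p≢q with any? (λ x → (x ∈? q) ×-dec ¬? (x ∈? p))
... | yes (x , x∈q , x∉p) = p⊆q , x , x∈q , x∉p
... | no ∄x = contradiction (⊆-antisym p⊆q q⊆p) p≢q
  where
  q⊆p : q ⊆ p
  q⊆p {x} x∈q with x ∈? p
  ... | yes x∈p = x∈p
  ... | no x∉p = contradiction (x , x∈q , x∉p) ∄x

elements : ∀ {n} → Subset n → List (Fin n)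
elements []          = []
elements (true ∷ p)  = zero ∷ map suc (elements p)
elements (false ∷ p) = map suc (elements p)

∈-elements⁺ : ∀ {n} {p : Subset n} {x} → x ∈ p → x ∈ₗ elements p
∈-elements⁺ {p = true ∷ p}  here        = Any.here refl
∈-elements⁺ {p = true ∷ p}  (there x∈p) = Any.there (∈-map⁺ suc (∈-elements⁺ x∈p))
∈-elements⁺ {p = false ∷ p} (there x∈p) = ∈-map⁺ suc (∈-elements⁺ x∈p)

∈-elements⁻ : ∀ {n} (p : Subset n) {x} → x ∈ₗ elements p → x ∈ p
∈-elements⁻ (true ∷ p)  (Any.here refl) = here
∈-elements⁻ (true ∷ p)  (Any.there x∈) with ∈-map⁻ suc x∈
... | _ , y∈ , refl = there (∈-elements⁻ p y∈)
∈-elements⁻ (false ∷ p) x∈ with ∈-map⁻ suc x∈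
... | _ , y∈ , refl = there (∈-elements⁻ p y∈)

length-elements : ∀ {n} (p : Subset n) → length (elements p) ≡ ∣ p ∣
length-elements []          = refl
length-elements (true ∷ p)  = cong suc (trans (length-map suc (elements p)) (length-elements p))
length-elements (false ∷ p) = trans (length-map suc (elements p)) (length-elements p)

module _ {n : ℕ} where

  path-endpoints : ∀ {G : Graph n} {T x y} → PathIn G T x y → x ∈ T × y ∈ T
  path-endpoints (here x∈T)     = x∈T , x∈T
  path-endpoints (step x∈T _ p) = x∈T , proj₂ (path-endpoints p)

  _++ₚ_ : ∀ {G : Graph n} {T x y z} → PathIn G T x y → PathIn G T y z → PathIn G T x z
  here _        ++ₚ q = q
  step x∈T xw p ++ₚ q = step x∈T xw (p ++ₚ q)

  path-mono : ∀ {G H : Graph n} → (∀ {x y} → adj G x y ≡ true → adj H x y ≡ true) →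
              ∀ {T x y} → PathIn G T x y → PathIn H T x y
  path-mono G⊆H (here x∈T)      = here x∈T
  path-mono G⊆H (step x∈T xw p) = step x∈T (G⊆H xw) (path-mono G⊆H p)

  ⊥-independent : (G : Graph n) → Independent G ⊥
  ⊥-independent G _ _ x∈⊥ = contradiction x∈⊥ ∉⊥

  ⁅⁆-independent : (G : Graph n) (v : Fin n) → Independent G ⁅ v ⁆
  ⁅⁆-independent G v x y x∈ y∈ rewrite x∈⁅y⁆⇒x≡y v x∈ | x∈⁅y⁆⇒x≡y v y∈ = irrefl G v

  Dominated : Graph n → Subset n → Fin n → Set
  Dominated G J v = v ∈ J ⊎ ∃ λ w → w ∈ J × adj G v w ≡ true

  Dominated-mono : ∀ {G J J′ v} → J ⊆ J′ → Dominated G J v → Dominated G J′ v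
  Dominated-mono J⊆J′ (inj₁ v∈J)            = inj₁ (J⊆J′ v∈J)
  Dominated-mono J⊆J′ (inj₂ (w , w∈J , vw)) = inj₂ (w , J⊆J′ w∈J , vw)

  dominating⇒maximal : ∀ {G S J} → IndepIn G S J → (∀ {v} → v ∈ S → Dominated G J v) →
                       MaximalIndepIn G S J
  dominating⇒maximal {G} {S} {J} indepIn dominates = indepIn , no-extension
    where
    no-extension : ∀ J′ → J ⊂ J′ → J′ ⊆ S → ¬ Independent G J′
    no-extension J′ (J⊆J′ , x , x∈J′ , x∉J) J′⊆S J′-indep with dominates (J′⊆S x∈J′)
    ... | inj₁ x∈J            = x∉J x∈J
    ... | inj₂ (w , w∈J , xw) = contradiction (trans (≡.sym xw) (J′-indep x w x∈J′ (J⊆J′ w∈J))) λ ()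

  maximal-nonempty : ∀ {G S I x} → MaximalIndepIn G S I → x ∈ S → ∃ λ v → v ∈ I
  maximal-nonempty {G} {S} {I} {x} (_ , maximal) x∈S with nonempty? I
  ... | yes nonempty = nonempty
  ... | no empty     = contradiction (⁅⁆-independent G x) (maximal ⁅ x ⁆ I⊂⁅x⁆ ⁅x⁆⊆S)
    where
    I⊂⁅x⁆ : I ⊂ ⁅ x ⁆
    I⊂⁅x⁆ = (λ {y} y∈I → contradiction (y , y∈I) empty) , x , x∈⁅x⁆ x , λ x∈I → empty (x , x∈I)
    ⁅x⁆⊆S : ⁅ x ⁆ ⊆ S
    ⁅x⁆⊆S y∈ rewrite x∈⁅y⁆⇒x≡y x y∈ = x∈S

module StarQuery {n : ℕ} (G : Graph n) {I : Subset n} (I-indep : Independent G I) (v : Fin n) where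

  Near : Fin n → Set
  Near x = x ≡ v ⊎ adj G x v ≡ true

  Linked : Fin n → Fin n → Set
  Linked x y = x ≡ y ⊎ Near x × Near y

  v∈star : v ∈ I ∪ ⁅ v ⁆
  v∈star = q⊆p∪q I ⁅ v ⁆ (x∈⁅x⁆ v)

  ∈-star⁻ : ∀ {x} → x ∈ I ∪ ⁅ v ⁆ → x ∈ I ⊎ x ≡ v
  ∈-star⁻ x∈ with x∈p∪q⁻ I ⁅ v ⁆ x∈
  ... | inj₁ x∈I = inj₁ x∈I
  ... | inj₂ x∈v = inj₂ (x∈⁅y⁆⇒x≡y v x∈v)

  edge-near : ∀ {x y} → x ∈ I ∪ ⁅ v ⁆ → y ∈ I ∪ ⁅ v ⁆ → adj G x y ≡ true → Near x × Near y
  edge-near {x} {y} x∈ y∈ xy with ∈-star⁻ x∈ | ∈-star⁻ y∈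
  ... | inj₂ refl | _         = inj₁ refl , inj₂ (trans (sym G y x) xy)
  ... | inj₁ _    | inj₂ refl = inj₂ xy , inj₁ refl
  ... | inj₁ x∈I  | inj₁ y∈I  = contradiction (trans (≡.sym xy) (I-indep x y x∈I y∈I)) λ ()

  path⇒linked : ∀ {x y} → PathIn G (I ∪ ⁅ v ⁆) x y → Linked x y
  path⇒linked (here _) = inj₁ refl
  path⇒linked (step x∈ xw p) with edge-near x∈ (proj₁ (path-endpoints p)) xw | path⇒linked p
  ... | near-x , near-w | inj₁ refl          = inj₂ (near-x , near-w)
  ... | near-x , _      | inj₂ (_ , near-y) = inj₂ (near-x , near-y)

  linked⇒path : ∀ {x y} → x ∈ I ∪ ⁅ v ⁆ → y ∈ I ∪ ⁅ v ⁆ → Linked x y → PathIn G (I ∪ ⁅ v ⁆) x y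
  linked⇒path x∈ _  (inj₁ refl)              = here x∈
  linked⇒path x∈ y∈ (inj₂ (near-x , near-y)) = to-v x∈ near-x ++ₚ from-v y∈ near-y
    where
    to-v : ∀ {x} → x ∈ I ∪ ⁅ v ⁆ → Near x → PathIn G (I ∪ ⁅ v ⁆) x v
    to-v x∈ (inj₁ refl) = here x∈
    to-v x∈ (inj₂ xv)   = step x∈ xv (here v∈star)
    from-v : ∀ {y} → y ∈ I ∪ ⁅ v ⁆ → Near y → PathIn G (I ∪ ⁅ v ⁆) v y
    from-v y∈     (inj₁ refl) = here y∈
    from-v {y} y∈ (inj₂ yv)   = step v∈star (trans (sym G v y) yv) (here y∈)

  linked? : ∀ x y → Dec (Linked x y)
  linked? x y = (x ≟ y) ⊎-dec (near? x ×-dec near? y)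
    where
    near? : ∀ x → Dec (Near x)
    near? x = (x ≟ v) ⊎-dec (adj G x v ≟ᵇ true)

  linkedIn? : ∀ x y → Dec (x ∈ I ∪ ⁅ v ⁆ × y ∈ I ∪ ⁅ v ⁆ × Linked x y)
  linkedIn? x y = (x ∈? I ∪ ⁅ v ⁆) ×-dec (y ∈? I ∪ ⁅ v ⁆) ×-dec linked? x y

  answer : Answer n
  answer x y = does (linkedIn? x y)

  answer-isCC : CCAnswer G (I ∪ ⁅ v ⁆) answer
  answer-isCC x y = mk⇔
    (λ ans → let (x∈ , y∈ , linked) = does⇒ (linkedIn? x y) ans in linked⇒path x∈ y∈ linked)
    (λ p → let (x∈ , y∈) = path-endpoints p in dec-true (linkedIn? x y) (x∈ , y∈ , path⇒linked p))

  path⇒adjacent : ∀ {u} → u ≢ v → PathIn G (I ∪ ⁅ v ⁆) v u → adj G v u ≡ true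
  path⇒adjacent {u} u≢v p with path⇒linked p
  ... | inj₁ v≡u             = contradiction (≡.sym v≡u) u≢v
  ... | inj₂ (_ , inj₁ u≡v)  = contradiction u≡v u≢v
  ... | inj₂ (_ , inj₂ uv)   = trans (sym G v u) uv

module _ {n : ℕ} where

  ReportsNeighbour : Answer n → Subset n → Fin n → Set
  ReportsNeighbour A I v = ∃ λ u → u ∈ I × u ≢ v × A v u ≡ true

  reportsNeighbour? : ∀ A I v → Dec (ReportsNeighbour A I v)
  reportsNeighbour? A I v = any? λ u → (u ∈? I) ×-dec ¬? (u ≟ v) ×-dec (A v u ≟ᵇ true)

  extend : Subset n → Fin n → Answer n → Subset n
  extend I v A with reportsNeighbour? A I v
  ... | yes _ = I
  ... | no _  = I ∪ ⁅ v ⁆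

  ⊆-extend : ∀ {I v A} → I ⊆ extend I v A
  ⊆-extend {I} {v} {A} x∈I with reportsNeighbour? A I v
  ... | yes _ = x∈I
  ... | no _  = p⊆p∪q ⁅ v ⁆ x∈I

  extend-⊆ : ∀ {I v A S} → I ⊆ S → v ∈ S → extend I v A ⊆ S
  extend-⊆ {I} {v} {A} I⊆S v∈S x∈ with reportsNeighbour? A I v
  ... | yes _ = I⊆S x∈
  ... | no _ with x∈p∪q⁻ I ⁅ v ⁆ x∈
  ...   | inj₁ x∈I = I⊆S x∈I
  ...   | inj₂ x∈v rewrite x∈⁅y⁆⇒x≡y v x∈v = v∈S

  module _ {G : Graph n} {I : Subset n} (I-indep : Independent G I) (v : Fin n)
           {A : Answer n} (cc : CCAnswer G (I ∪ ⁅ v ⁆) A) where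

    open StarQuery G I-indep v

    unreported⇒nonadjacent : ¬ ReportsNeighbour A I v → ∀ {u} → u ∈ I → adj G v u ≡ false
    unreported⇒nonadjacent unreported {u} u∈I with u ≟ v
    ... | yes refl = irrefl G u
    ... | no u≢v   = ¬-not λ vu →
      unreported (u , u∈I , u≢v ,
                  Equivalence.from (cc v u) (step v∈star vu (here (p⊆p∪q ⁅ v ⁆ u∈I))))

    extend-independent : Independent G (extend I v A)
    extend-independent x y x∈ y∈ with reportsNeighbour? A I v
    ... | yes _ = I-indep x y x∈ y∈
    ... | no unreported with ∈-star⁻ x∈ | ∈-star⁻ y∈
    ...   | inj₁ x∈I  | inj₁ y∈I  = I-indep x y x∈I y∈I
    ...   | inj₂ refl | inj₂ refl = irrefl G x
    ...   | inj₂ refl | inj₁ y∈I  = unreported⇒nonadjacent unreported y∈I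
    ...   | inj₁ x∈I  | inj₂ refl = trans (sym G x y) (unreported⇒nonadjacent unreported x∈I)

    extend-dominates : Dominated G (extend I v A) v
    extend-dominates with reportsNeighbour? A I v
    ... | yes (u , u∈I , u≢v , Avu) =
      inj₂ (u , u∈I , path⇒adjacent u≢v (Equivalence.to (cc v u) Avu))
    ... | no _                      = inj₁ v∈star

  greedy : List (Fin n) → Subset n → Alg n
  greedy []       I = ret I
  greedy (v ∷ vs) I = ask (I ∪ ⁅ v ⁆) (greedy vs ∘ extend I v)

  module _ {G : Graph n} where

    greedy-queries : ∀ vs {I J k} → Run G (greedy vs I) J k → k ≡ length vs
    greedy-queries []       ret       = refl
    greedy-queries (v ∷ vs) (ask _ r) = cong suc (greedy-queries vs r)

    greedy-⊇ : ∀ vs {I J k} → Run G (greedy vs I) J k → I ⊆ J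
    greedy-⊇ []       ret       = id
    greedy-⊇ (v ∷ vs) (ask _ r) = greedy-⊇ vs r ∘ ⊆-extend

    greedy-⊆ : ∀ vs {I J k S} → I ⊆ S → (∀ {v} → v ∈ₗ vs → v ∈ S) →
               Run G (greedy vs I) J k → J ⊆ S
    greedy-⊆ []       I⊆S vs⊆S ret       = I⊆S
    greedy-⊆ (v ∷ vs) I⊆S vs⊆S (ask _ r) =
      greedy-⊆ vs (extend-⊆ I⊆S (vs⊆S (Any.here refl))) (vs⊆S ∘ Any.there) r

    greedy-independent : ∀ vs {I J k} → Independent G I → Run G (greedy vs I) J k →
                         Independent G J
    greedy-independent []       I-indep ret        = I-indep
    greedy-independent (v ∷ vs) I-indep (ask cc r) =
      greedy-independent vs (extend-independent I-indep v cc) r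

    greedy-dominates : ∀ vs {I J k} → Independent G I → Run G (greedy vs I) J k →
                       ∀ {x} → x ∈ₗ vs → Dominated G J x
    greedy-dominates (v ∷ vs) I-indep (ask cc r) (Any.here refl) =
      Dominated-mono {G = G} (greedy-⊇ vs r) (extend-dominates I-indep v cc)
    greedy-dominates (v ∷ vs) I-indep (ask cc r) (Any.there x∈vs) =
      greedy-dominates vs (extend-independent I-indep v cc) r x∈vs

    greedy-terminates : ∀ vs {I} → Independent G I → ∃ λ J → ∃ λ k → Run G (greedy vs I) J k
    greedy-terminates []       I-indep = _ , zero , ret
    greedy-terminates (v ∷ vs) I-indep =
      let cc          = StarQuery.answer-isCC G I-indep v
          (J , k , r) = greedy-terminates vs (extend-independent I-indep v cc)
      in J , suc k , ask cc r

  misAlgorithm : Subset n → Alg n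
  misAlgorithm S = greedy (elements S) ⊥

  misAlgorithm-computesMIS : ∀ G S → ComputesMIS G S (misAlgorithm S)
  misAlgorithm-computesMIS G S = greedy-terminates (elements S) (⊥-independent G) , is-MIS
    where
    is-MIS : ∀ J k → Run G (misAlgorithm S) J k → MaximalIndepIn G S J
    is-MIS J k r = dominating⇒maximal {G = G}
      (greedy-⊆ (elements S) (λ x∈⊥ → contradiction x∈⊥ ∉⊥) (∈-elements⁻ S) r ,
       greedy-independent (elements S) (⊥-independent G) r)
      (greedy-dominates (elements S) (⊥-independent G) r ∘ ∈-elements⁺)

  misAlgorithm-queries : ∀ {G} S {J k} → Run G (misAlgorithm S) J k → k ≡ ∣ S ∣
  misAlgorithm-queries S r = trans (greedy-queries (elements S) r) (length-elements S)

module _ {n : ℕ} where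

  graphOf : {E : Fin n → Fin n → Set} → Decidable E → Symmetric E → (∀ x → ¬ E x x) → Graph n
  graphOf E? E-sym E-irrefl = record
    { adj    = λ x y → does (E? x y)
    ; sym    = λ x y → does-⇔ (mk⇔ E-sym E-sym) (E? x y) (E? y x)
    ; irrefl = λ x → dec-false (E? x x) (E-irrefl x)
    }

  complete : Graph n
  complete = graphOf (λ x y → ¬? (x ≟ y)) (λ x≢y → x≢y ∘ ≡.sym) (λ x x≢x → x≢x refl)

  complete-adj : ∀ {x y} → x ≢ y → adj complete x y ≡ true
  complete-adj {x} {y} = dec-true (¬? (x ≟ y))

  complete-independent : ∀ {I v} → Independent complete I → v ∈ I → ∀ {x} → x ∈ I → x ≡ v
  complete-independent {v = v} I-indep v∈I {x} x∈I with x ≟ v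
  ... | yes x≡v = x≡v
  ... | no x≢v  = contradiction (trans (≡.sym (complete-adj x≢v)) (I-indep x v x∈I v∈I)) λ ()

  pair : Fin n → Fin n → Subset n
  pair v w = ⁅ v ⁆ ∪ ⁅ w ⁆

  ∈-pairˡ : ∀ v w → v ∈ pair v w
  ∈-pairˡ v w = p⊆p∪q ⁅ w ⁆ (x∈⁅x⁆ v)

  ∈-pairʳ : ∀ v w → w ∈ pair v w
  ∈-pairʳ v w = q⊆p∪q ⁅ v ⁆ ⁅ w ⁆ (x∈⁅x⁆ w)

  ∈-pair⁻ : ∀ {v w x} → x ∈ pair v w → x ≡ v ⊎ x ≡ w
  ∈-pair⁻ {v} {w} x∈ with x∈p∪q⁻ ⁅ v ⁆ ⁅ w ⁆ x∈
  ... | inj₁ x∈v = inj₁ (x∈⁅y⁆⇒x≡y v x∈v)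
  ... | inj₂ x∈w = inj₂ (x∈⁅y⁆⇒x≡y w x∈w)

  pair-injectiveʳ : ∀ {v w w′} → w ≢ v → pair v w ≡ pair v w′ → w ≡ w′
  pair-injectiveʳ {v} {w} w≢v eq with ∈-pair⁻ (subst (w ∈_) eq (∈-pairʳ v w))
  ... | inj₁ w≡v  = contradiction w≡v w≢v
  ... | inj₂ w≡w′ = w≡w′

  pair-⊆ : ∀ {v w x y T} → x ≢ y → x ∈ pair v w → y ∈ pair v w → x ∈ T → y ∈ T → pair v w ⊆ T
  pair-⊆ x≢y x∈ y∈ x∈T y∈T z∈ with ∈-pair⁻ x∈ | ∈-pair⁻ y∈ | ∈-pair⁻ z∈
  ... | inj₁ refl | inj₁ refl | _         = contradiction refl x≢y
  ... | inj₂ refl | inj₂ refl | _         = contradiction refl x≢y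
  ... | inj₁ refl | inj₂ refl | inj₁ refl = x∈T
  ... | inj₁ refl | inj₂ refl | inj₂ refl = y∈T
  ... | inj₂ refl | inj₁ refl | inj₁ refl = y∈T
  ... | inj₂ refl | inj₁ refl | inj₂ refl = x∈T

  module _ (v w : Fin n) where

    NonEdge : Fin n → Fin n → Set
    NonEdge x y = x ≢ y × ¬ (x ∈ pair v w × y ∈ pair v w)

    nonEdge? : ∀ x y → Dec (NonEdge x y)
    nonEdge? x y = ¬? (x ≟ y) ×-dec ¬? ((x ∈? pair v w) ×-dec (y ∈? pair v w))

    completeMinusEdge : Graph n
    completeMinusEdge =
      graphOf nonEdge? (λ (x≢y , ¬both) → x≢y ∘ ≡.sym , ¬both ∘ swap) (λ x (x≢x , _) → x≢x refl)

    completeMinusEdge⊆complete : ∀ {x y} → adj completeMinusEdge x y ≡ true →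
                                 adj complete x y ≡ true
    completeMinusEdge⊆complete {x} {y} xy = complete-adj (proj₁ (does⇒ (nonEdge? x y) xy))

    pair-independent : Independent completeMinusEdge (pair v w)
    pair-independent x y x∈ y∈ = dec-false (nonEdge? x y) λ (_ , ¬both) → ¬both (x∈ , y∈)

    outside-pair-adj : ∀ {x z} → x ∈ pair v w → z ∉ pair v w → adj completeMinusEdge x z ≡ true
    outside-pair-adj {x} {z} x∈ z∉ = dec-true (nonEdge? x z) ((λ { refl → z∉ x∈ }) , z∉ ∘ proj₂)

    completeMinusEdge-connected : ∀ {T x y} → T ≢ pair v w → x ∈ T → y ∈ T →
                                  PathIn completeMinusEdge T x y
    completeMinusEdge-connected {T} {x} {y} T≢vw x∈T y∈T with x ≟ y
    ... | yes refl = here x∈T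
    ... | no x≢y with (x ∈? pair v w) ×-dec (y ∈? pair v w)
    ...   | no ¬both = step x∈T (dec-true (nonEdge? x y) (x≢y , ¬both)) (here y∈T)
    ...   | yes (x∈ , y∈) with ⊆∧≢⇒⊂ (pair-⊆ x≢y x∈ y∈ x∈T y∈T) (T≢vw ∘ ≡.sym)
    ...     | _ , z , z∈T , z∉ =
      step x∈T (outside-pair-adj x∈ z∉)
        (step z∈T (trans (sym completeMinusEdge z y) (outside-pair-adj y∈ z∉)) (here y∈T))

    complete⇒completeMinusEdge-CC : ∀ {T A} → T ≢ pair v w →
                                    CCAnswer complete T A → CCAnswer completeMinusEdge T A
    complete⇒completeMinusEdge-CC T≢vw cc x y = mk⇔
      (λ Axy → let (x∈T , y∈T) = path-endpoints (Equivalence.to (cc x y) Axy)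
               in completeMinusEdge-connected T≢vw x∈T y∈T)
      (Equivalence.from (cc x y) ∘ path-mono (λ {x} {y} → completeMinusEdge⊆complete {x} {y}))

  query : ∀ {G : Graph n} {a I k} → Run G a I k → Fin k → Subset n
  query (ask {T} _ _) zero    = T
  query (ask _ r)     (suc i) = query r i

  run-transfer : ∀ {G H : Graph n} {P : Subset n → Set} →
                 (∀ {T A} → P T → CCAnswer G T A → CCAnswer H T A) →
                 ∀ {a I k} (r : Run G a I k) → (∀ i → P (query r i)) → Run H a I k
  run-transfer G⇒H ret        _    = ret
  run-transfer G⇒H (ask cc r) good = ask (G⇒H (good zero) cc) (run-transfer G⇒H r (good ∘ suc))

module _ {m : ℕ} {a : Alg (suc m)} (correct : ∀ G → ComputesMIS G ⊤ a)
         {I k} (r : Run complete a I k) where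

  private
    I-maximal : MaximalIndepIn complete ⊤ I
    I-maximal = proj₂ (correct complete) I k r

    I-nonempty : ∃ λ v → v ∈ I
    I-nonempty = maximal-nonempty {G = complete} I-maximal (∈⊤ {x = zero})

    v : Fin (suc m)
    v = proj₁ I-nonempty

    I≡v : ∀ {x} → x ∈ I → x ≡ v
    I≡v = complete-independent (proj₂ (proj₁ I-maximal)) (proj₂ I-nonempty)

  pair-queried : ∀ {w} → w ≢ v → ∃ λ i → query r i ≡ pair v w
  pair-queried {w} w≢v with any? (λ i → ≡-dec _≟ᵇ_ (query r i) (pair v w))
  ... | yes found = found
  ... | no never  =
    contradiction (pair-independent v w) (proj₂ (proj₂ (correct G′) I k r′) (pair v w) I⊂vw ⊆⊤)
    where
    G′ : Graph (suc m)
    G′ = completeMinusEdge v w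
    r′ : Run G′ a I k
    r′ = run-transfer (complete⇒completeMinusEdge-CC v w) r (λ i q≡vw → never (i , q≡vw))
    I⊂vw : I ⊂ pair v w
    I⊂vw = (λ x∈I → subst (_∈ pair v w) (≡.sym (I≡v x∈I)) (∈-pairˡ v w)) ,
           w , ∈-pairʳ v w , w≢v ∘ I≡v

  pair-queries : m ≤ k
  pair-queries = injective⇒≤ {f = pair-index} pair-index-injective
    where
    pair-index : Fin m → Fin k
    pair-index j = proj₁ (pair-queried (punchInᵢ≢i v j))
    pair-index-injective : ∀ {j j′} → pair-index j ≡ pair-index j′ → j ≡ j′
    pair-index-injective {j} {j′} eq =
      punchIn-injective v j j′ (pair-injectiveʳ (punchInᵢ≢i v j) (begin
        pair v (punchIn v j)    ≡⟨ ≡.sym (proj₂ (pair-queried (punchInᵢ≢i v j))) ⟩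
        query r (pair-index j)  ≡⟨ cong (query r) eq ⟩
        query r (pair-index j′) ≡⟨ proj₂ (pair-queried (punchInᵢ≢i v j′)) ⟩
        pair v (punchIn v j′)   ∎))
      where open ≡.≡-Reasoning

complete-queries : ∀ s {a : Alg s} → (∀ G → ComputesMIS G ⊤ a) →
                   ∀ {I k} → Run complete a I k → s ≤ k + 1
complete-queries zero    _               _ = z≤n
complete-queries (suc m) correct {k = k} r =
  subst (suc m ≤_) (+-comm 1 k) (s≤s (pair-queries correct r))

theorem15 :
  -- upper bound: O(|S|) queries suffice, uniformly for all n, hidden G, S
  Σ ℕ (λ c → ∀ (n : ℕ) (S : Subset n) → Σ (Alg n) (λ a →
      ∀ (G : Graph n) → ComputesMIS G S a ×
        (∀ I k → Run G a I k → k ≤ c * ∣ S ∣)))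
  ×
  -- lower bound: for every size s there is an instance (V, S) with |S| = s
  -- on which every correct algorithm makes ≥ |S|/c - 1 queries on some graph
  Σ ℕ (λ c → ∀ (s : ℕ) → Σ ℕ (λ n → Σ (Subset n) (λ S → ∣ S ∣ ≡ s ×
      (∀ (a : Alg n) → (∀ (G : Graph n) → ComputesMIS G S a) →
        Σ (Graph n) (λ G → Σ (Subset n) (λ I → Σ ℕ (λ k →
          Run G a I k × ∣ S ∣ ≤ c * (k + 1))))))))
theorem15 =
  (1 , λ n S → misAlgorithm S , λ G → misAlgorithm-computesMIS G S ,
     λ I k r → ≤-reflexive (trans (misAlgorithm-queries S r) (≡.sym (*-identityˡ ∣ S ∣)))) ,
  (1 , λ s → s , ⊤ , ∣⊤∣≡n s , λ a correct →
     let (I , k , r) = proj₁ (correct complete)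
     in complete , I , k , r ,
        subst₂ _≤_ (≡.sym (∣⊤∣≡n s)) (≡.sym (*-identityˡ (k + 1))) (complete-queries s correct r))
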